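{- There is a deterministic sorting algorithm with error $2$ that, given $n$ elements, requires at most $4n^{3/2}$ comparisons; i.e. it outputs an ordering $x_{\pi(1)},\dots,x_{\pi(n)}$ with $\mathrm{val}(x_{\pi(i)})\ge \mathrm{val}(x_{\pi(j)})-2$ for all $i>j$.
   Context: Model: each element $x_i$ has an unknown real value $\mathrm{val}(x_i)$. A comparator query on $x_i,x_j$ returns "$x_i\ge x_j$" or "$x_j\ge x_i$"; the answer is correct if $|\mathrm{val}(x_i)-\mathrm{val}(x_j)|>1$ and arbitrary (possibly adversarial) otherwise. The guarantee must hold for every input and every consistent comparator behavior.
   Formalization: The unknown values $\mathrm{val}(x_i)$ of the elements are rational instead of real. -}

module Defs where

open import Data.Nat using (ℕ; zero; suc)
open import Data.Bool using (Bool; true; false)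
open import Data.Fin using (Fin) renaming (_<_ to _<ᶠ_)
open import Data.Fin.Permutation using (Permutation′; _⟨$⟩ʳ_)
open import Data.Rational using (ℚ; _+_; _≤_; 1ℚ)
open import Data.Empty using (⊥)

-- A deterministic comparison algorithm on n elements, as a decision tree.
-- `ask i j k` queries the comparator on (x_i, x_j); the answer `true` means
-- "x_i ≥ x_j", `false` means "x_j ≥ x_i"; the algorithm continues with k answer.
-- `done π` outputs the ordering x_{π(0)}, …, x_{π(n-1)}.
data Alg (n : ℕ) : Set where
  done : Permutation′ n → Alg n
  ask  : Fin n → Fin n → (Bool → Alg n) → Alg n

-- An answer to a query on (x_i, x_j) is admissible (consistent with the model):
-- it must be correct whenever |val i - val j| > 1, and is arbitrary otherwise.
Admissible : {n : ℕ} → (Fin n → ℚ) → Fin n → Fin n → Bool → Set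
Admissible val i j true  = val j ≤ val i + 1ℚ
Admissible val i j false = val i ≤ val j + 1ℚ

two : ℚ
two = 1ℚ + 1ℚ

ErrorAtMost2 : {n : ℕ} → (Fin n → ℚ) → Permutation′ n → Set
ErrorAtMost2 {n} val π =
  (p q : Fin n) → q <ᶠ p → val (π ⟨$⟩ʳ q) ≤ val (π ⟨$⟩ʳ p) + two

-- `SortsWithin val A d`: against EVERY (possibly adaptive, adversarial) sequence
-- of admissible comparator answers for the values `val`, the algorithm A makes
-- at most d comparisons and its output has error at most 2.
SortsWithin : {n : ℕ} → (Fin n → ℚ) → Alg n → ℕ → Set
SortsWithin val (done π)    d       = ErrorAtMost2 val π
SortsWithin val (ask i j k) zero    = ⊥
SortsWithin val (ask i j k) (suc d) =
  (b : Bool) → Admissible val i j b → SortsWithin val (k b) d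

{-# OPTIONS --safe #-}

-- The algorithm is a quicksort. Whatever the pivot v, an element put below v was reported ≤ v,
-- so its value is at most val v + 1, and an element put above v has value at least val v - 1;
-- hence any two elements of the output that are out of order differ by at most 2.
--
-- Pivots are taken from a sample of s = 4k + 1 elements whose
-- pairwise answers are recorded in a table, and in every tournament on at least 4k - 1 players
-- some player has at least k wins and k losses; such a pivot leaves k sample elements on each
-- side. The two halves of the sample are reused by the recursive calls, so an element costs at
-- most s queries when it joins a sample. Partitioning costs one query per unsampled element and
-- is paid for by the potential ⌊m (m + 2K) / 2K⌋ (K = k + 1) of a subproblem with m elements,
-- which drops by at least that much at a pivot with k sample elements on each side. Choosing the
-- largest k with (k + 1)(2k + 1) ≤ n gives at most 4 n^(3/2) queries.
module Submission where

open import Defs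
open import Data.Bool using (Bool; true; false; not; if_then_else_; _∧_; T?)
import Data.Bool as Bool
open import Data.Bool.Properties using (∧-zeroʳ; not-involutive; T-≡; T-not-≡)
open import Data.Empty using (⊥; ⊥-elim)
open import Data.Fin using (Fin; zero; suc; toℕ; cast; _≟_)
open import Data.Fin.Permutation using (Permutation′; _⟨$⟩ʳ_; _∘ₚ_; cast-id)
open import Data.Fin.Properties using (toℕ-cast; cast-involutive)
open import Data.List using (List; []; _∷_; _++_; [_]; length; lookup; allFin; filter; filterᵇ; map)
open import Data.List.Membership.Propositional using (_∈_; find)
open import Data.List.Membership.Propositional.Properties
  using (∈-lookup; ∈-filter⁻; ∈-∃++; ∈-++⁻; ∈-++⁺ˡ; ∈-++⁺ʳ; ∈-insert)
open import Data.List.Properties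
  using (length-tabulate; lookup-tabulate; length-++; ++-assoc; filter-accept; filter-reject; filter-all; filter-++)
open import Data.List.Relation.Binary.Permutation.Propositional
  using (_↭_; ↭⇒↭ₛ; ↭-refl; ↭-sym; ↭-trans; ↭-reflexive; prep; module PermutationReasoning)
open import Data.List.Relation.Binary.Permutation.Propositional.Properties
  using (shift; shifts; ↭-length; ++⁺; ++⁺ˡ; ++⁺ʳ; All-resp-↭)
import Data.List.Relation.Binary.Permutation.Setoid as ↭ₛ
import Data.List.Relation.Binary.Permutation.Setoid.Properties as ↭ₛᴾ
open import Data.List.Relation.Binary.Sublist.Propositional using (_⊆_)
open import Data.List.Relation.Binary.Sublist.Propositional.Properties using (filter-⊆; filter⁺; length-mono-≤)
open import Data.List.Relation.Unary.All using (All; []; _∷_)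
import Data.List.Relation.Unary.All as All
open import Data.List.Relation.Unary.All.Properties
  using (¬Any⇒All¬) renaming (++⁺ to All-++⁺; ++⁻ˡ to All-++⁻ˡ)
open import Data.List.Relation.Unary.AllPairs using (AllPairs; []; _∷_)
import Data.List.Relation.Unary.AllPairs as AllPairs
import Data.List.Relation.Unary.AllPairs.Properties as AllPairsᴾ
open import Data.List.Relation.Unary.Any using (Any; here; there; any?)
open import Data.List.Relation.Unary.Unique.Propositional using (Unique)
open import Data.List.Relation.Unary.Unique.Propositional.Properties using (allFin⁺)
open import Data.Nat
  using (ℕ; zero; suc; _+_; _*_; _^_; _≤_; _<_; _≤?_; _<?_; z≤n; s≤s; s≤s⁻¹; NonZero)
open import Data.Nat.Combinatorics using (_C_; nC1≡n; nCk+nC[k+1]≡[n+1]C[k+1])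
open import Data.Nat.DivMod using (_/_; m/n*n≤m; /-monoˡ-≤; m*n/n≡m; +-distrib-/-∣ˡ)
open import Data.Nat.Divisibility using (divides-refl)
open import Data.Nat.ListAction using (sum)
open import Data.Nat.Properties hiding (_≟_)
open import Data.Nat.Tactic.RingSolver using (solve-∀)
open import Algebra.Properties.CommutativeSemigroup +-commutativeSemigroup using (interchange)
open import Data.Product using (Σ; ∃-syntax; _×_; _,_; proj₁; proj₂)
import Data.Product as Product
open import Data.Rational using (ℚ; 1ℚ)
import Data.Rational as ℚ
import Data.Rational.Properties as ℚ
open import Data.Sum using (_⊎_; inj₁; inj₂)
import Data.Sum as Sum
open import Function using (id; _∘_)
open import Function.Bundles using (Equivalence)
open import Relation.Binary.Definitions using (DecidableEquality)
open import Relation.Binary.PropositionalEquality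
  using (_≡_; _≢_; refl; sym; trans; cong; cong₂; subst; subst₂; ≢-sym; setoid; module ≡-Reasoning)
open import Relation.Nullary using (¬_; Dec; does; yes; no; ¬?; _×-dec_)
open import Relation.Nullary.Decidable using (dec-true; dec-false; toWitness)

private variable
  n : ℕ
  A B : Set

data Query (n : ℕ) (A : Set) : Set where
  pure  : A → Query n A
  query : Fin n → Fin n → (Bool → Query n A) → Query n A

_>>=_ : Query n A → (A → Query n B) → Query n B
pure a      >>= f = f a
query i j k >>= f = query i j λ b → k b >>= f

toAlg : Query n (Permutation′ n) → Alg n
toAlg (pure π)      = done π
toAlg (query i j k) = ask i j λ b → toAlg (k b)

-- The postcondition also sees how much of the budget is left unused.
Runs : (Fin n → ℚ) → Query n A → ℕ → (A → ℕ → Set) → Set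
Runs val (pure a)      d       Q = Q a d
Runs val (query i j k) zero    Q = ⊥
Runs val (query i j k) (suc d) Q = ∀ b → Admissible val i j b → Runs val (k b) d Q

module _ {val : Fin n → ℚ} where

  Runs-bind : ∀ (m : Query n A) {f : A → Query n B} {d P Q} → Runs val m d P →
              (∀ a e → P a e → Runs val (f a) e Q) → Runs val (m >>= f) d Q
  Runs-bind (pure a)      run g = g a _ run
  Runs-bind (query i j k) {d = suc d} run g = λ b adm → Runs-bind (k b) (run b adm) g

  Runs-≤ : ∀ (m : Query n A) {d d′} {P : A → Set} {B : A → ℕ} → d ≤ d′ →
           Runs val m d (λ a e → P a × B a ≤ e) → Runs val m d′ (λ a e → P a × B a ≤ e)
  Runs-≤ (pure a)      d≤d′       (p , b≤d) = p , ≤-trans b≤d d≤d′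
  Runs-≤ (query i j k) (s≤s d≤d′) run       = λ b adm → Runs-≤ (k b) d≤d′ (run b adm)

  toAlg-sortsWithin : ∀ (m : Query n (Permutation′ n)) {d} →
                      Runs val m d (λ π _ → ErrorAtMost2 val π) → SortsWithin val (toAlg m) d
  toAlg-sortsWithin (pure π)      run = run
  toAlg-sortsWithin (query i j k) {suc d} run = λ b adm → toAlg-sortsWithin (k b) (run b adm)

AllPairs-lookup : ∀ {R : A → A → Set} {xs : List A} → AllPairs R xs →
                  ∀ {i j} → toℕ i < toℕ j → R (lookup xs i) (lookup xs j)
AllPairs-lookup (r ∷ rs) {zero}  {suc j} _         = All.lookup r (∈-lookup j)
AllPairs-lookup (r ∷ rs) {suc i} {suc j} (s≤s i<j) = AllPairs-lookup rs i<j

AllPairs-++⁻ : ∀ {R : A → A → Set} xs {ys} → AllPairs R (xs ++ ys) → AllPairs R xs × AllPairs R ys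
AllPairs-++⁻ []       rs       = [] , rs
AllPairs-++⁻ (x ∷ xs) (r ∷ rs) = let rxs , rys = AllPairs-++⁻ xs rs in All-++⁻ˡ xs r ∷ rxs , rys

Unique-resp-↭ : ∀ {xs ys : List A} → xs ↭ ys → Unique xs → Unique ys
Unique-resp-↭ {A = A} p = ↭ₛᴾ.Unique-resp-↭ (setoid A) (↭⇒↭ₛ p)

↭-interchange : ∀ (a b c d : List A) → (a ++ b) ++ (c ++ d) ↭ (a ++ c) ++ (b ++ d)
↭-interchange a b c d = ↭-trans (↭-reflexive (++-assoc a b (c ++ d)))
                       (↭-trans (++⁺ˡ a (shifts b c)) (↭-reflexive (sym (++-assoc a c (b ++ d)))))

filterᵇ-++-not↭ : ∀ (p : A → Bool) xs → filterᵇ p xs ++ filterᵇ (not ∘ p) xs ↭ xs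
filterᵇ-++-not↭ p []       = ↭-refl
filterᵇ-++-not↭ p (x ∷ xs) with p x
... | true  = prep x (filterᵇ-++-not↭ p xs)
... | false = ↭-trans (shift x _ _) (prep x (filterᵇ-++-not↭ p xs))

length-filter-⊎ : ∀ {P Q : A → Set} (P? : ∀ x → Dec (P x)) (Q? : ∀ x → Dec (Q x)) {xs} →
                  All (λ x → P x ⊎ Q x) xs → length xs ≤ length (filter P? xs) + length (filter Q? xs)
length-filter-⊎ P? Q? {[]}     []                 = z≤n
length-filter-⊎ P? Q? {x ∷ xs} (px⊎qx ∷ pqs) with ih ← length-filter-⊎ P? Q? pqs | P? x | Q? x | px⊎qx
... | yes _ | yes _ | _      = s≤s (≤-trans ih (+-monoʳ-≤ _ (n≤1+n _)))
... | yes _ | no _  | _      = s≤s ih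
... | no _  | yes _ | _      = ≤-trans (s≤s ih) (≤-reflexive (sym (+-suc _ _)))
... | no ¬p | no _  | inj₁ p = ⊥-elim (¬p p)
... | no _  | no ¬q | inj₂ q = ⊥-elim (¬q q)

length-filterᵇ-∷ : ∀ (p : A → Bool) x xs →
                   length (filterᵇ p (x ∷ xs)) ≡ length (filterᵇ p [ x ]) + length (filterᵇ p xs)
length-filterᵇ-∷ p x xs = trans (cong length (filter-++ (T? ∘ p) [ x ] xs)) (length-++ (filterᵇ p [ x ]))

length-filterᵇ-[] : ∀ {p q : A → Bool} {x y} → p x ≡ q y →
                    length (filterᵇ p [ x ]) ≡ length (filterᵇ q [ y ])
length-filterᵇ-[] {p = p} {q} {x} {y} eq with p x | q y | eq
... | true  | true  | _ = refl
... | false | false | _ = refl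

sum-map-≤ : ∀ {f : A → ℕ} {c} {xs} → All (λ x → f x ≤ c) xs → sum (map f xs) ≤ length xs * c
sum-map-≤ []       = z≤n
sum-map-≤ (h ∷ hs) = +-mono-≤ h (sum-map-≤ hs)

AlmostSorted : (Fin n → ℚ) → List (Fin n) → Set
AlmostSorted val = AllPairs λ x y → val x ℚ.≤ val y ℚ.+ two

+1⇒+2 : ∀ {a} b → a ℚ.≤ b ℚ.+ 1ℚ → a ℚ.≤ b ℚ.+ two
+1⇒+2 b h = ℚ.≤-trans h (ℚ.+-monoʳ-≤ b (toWitness {a? = 1ℚ ℚ.≤? two} _))

+1-trans : ∀ {a} b c → a ℚ.≤ b ℚ.+ 1ℚ → b ℚ.≤ c ℚ.+ 1ℚ → a ℚ.≤ c ℚ.+ two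
+1-trans b c a≤b+1 b≤c+1 =
  ℚ.≤-trans a≤b+1 (ℚ.≤-trans (ℚ.+-monoˡ-≤ 1ℚ b≤c+1) (ℚ.≤-reflexive (ℚ.+-assoc c 1ℚ 1ℚ)))

AlmostSorted-around : ∀ {val : Fin n → ℚ} {v LB LA} →
                      AlmostSorted val LB → AlmostSorted val LA →
                      All (λ b → val b ℚ.≤ val v ℚ.+ 1ℚ) LB → All (λ a → val v ℚ.≤ val a ℚ.+ 1ℚ) LA →
                      AlmostSorted val (LB ++ v ∷ LA)
AlmostSorted-around {val = val} {v} {LA = LA} sortedB sortedA belowB aboveA =
  AllPairsᴾ.++⁺ sortedB (All.map (λ {a} → +1⇒+2 (val a)) aboveA ∷ sortedA) (All.map beforeAll belowB)
  where
  beforeAll : ∀ {b} → val b ℚ.≤ val v ℚ.+ 1ℚ → All (λ y → val b ℚ.≤ val y ℚ.+ two) (v ∷ LA)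
  beforeAll b≤v = +1⇒+2 (val v) b≤v ∷ All.map (λ {a} → +1-trans (val v) (val a) b≤v) aboveA

length-allFin : ∀ n → length (allFin n) ≡ n
length-allFin n = length-tabulate id

module _ {n : ℕ} (L : List (Fin n)) (L↭ : L ↭ allFin n) where

  private
    length-L : length L ≡ n
    length-L = trans (↭-length L↭) (length-allFin n)

    lookup-allFin : ∀ i → lookup (allFin n) i ≡ cast (length-allFin n) i
    lookup-allFin i = trans (cong (lookup (allFin n)) (sym (cast-involutive _ (length-allFin n) i)))
                            (lookup-tabulate id (cast (length-allFin n) i))

  listPermutation : Permutation′ n
  listPermutation =
    cast-id (sym length-L) ∘ₚ (↭ₛ.onIndices (↭⇒↭ₛ L↭) ∘ₚ cast-id (length-allFin n))

  listPermutation-lookup : ∀ i → listPermutation ⟨$⟩ʳ i ≡ lookup L (cast (sym length-L) i)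
  listPermutation-lookup i =
    sym (trans (↭ₛᴾ.onIndices-lookup (setoid (Fin n)) (↭⇒↭ₛ L↭) (cast (sym length-L) i))
               (lookup-allFin _))

  listPermutation-error : ∀ {val} → AlmostSorted val L → ErrorAtMost2 val listPermutation
  listPermutation-error sorted p q q<p
    rewrite listPermutation-lookup p | listPermutation-lookup q =
    AllPairs-lookup sorted (subst₂ _<_ (sym (toℕ-cast _ q)) (sym (toℕ-cast _ p)) q<p)

-- Tournaments

[1+m]C2≡m+mC2 : ∀ m → suc m C 2 ≡ m + m C 2
[1+m]C2≡m+mC2 m = trans (sym (nCk+nC[k+1]≡[n+1]C[k+1] m 1)) (cong (_+ m C 2) (nC1≡n m))

2*[1+m]C2≡[1+m]*m : ∀ m → 2 * (suc m C 2) ≡ suc m * m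
2*[1+m]C2≡[1+m]*m zero    = refl
2*[1+m]C2≡[1+m]*m (suc m) = begin
  2 * (suc (suc m) C 2)       ≡⟨ cong (2 *_) ([1+m]C2≡m+mC2 (suc m)) ⟩
  2 * (suc m + suc m C 2)     ≡⟨ *-distribˡ-+ 2 (suc m) _ ⟩
  2 * suc m + 2 * (suc m C 2) ≡⟨ cong (2 * suc m +_) (2*[1+m]C2≡[1+m]*m m) ⟩
  2 * suc m + suc m * m       ≡⟨ solve m ⟩
  suc (suc m) * suc m         ∎
  where
  open ≡-Reasoning
  solve : ∀ m → 2 * suc m + suc m * m ≡ suc (suc m) * suc m
  solve = solve-∀

mC2≤m*k⇒m≤1+2k : ∀ m k → m C 2 ≤ m * k → m ≤ suc (2 * k)
mC2≤m*k⇒m≤1+2k zero    k _ = z≤n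
mC2≤m*k⇒m≤1+2k (suc m) k h = s≤s (*-cancelˡ-≤ (suc m) (begin
  suc m * m          ≡⟨ 2*[1+m]C2≡[1+m]*m m ⟨
  2 * (suc m C 2)    ≤⟨ *-monoʳ-≤ 2 h ⟩
  2 * (suc m * k)    ≡⟨ solve m k ⟩
  suc m * (2 * k)    ∎))
  where
  open ≤-Reasoning
  solve : ∀ m k → 2 * (suc m * k) ≡ suc m * (2 * k)
  solve = solve-∀

module Tournament {A : Set} (_≟_ : DecidableEquality A) where

  others : A → List A → List A
  others v = filter λ t → ¬? (t ≟ v)

  wins : (A → A → Bool) → List A → A → ℕ
  wins τ T v = length (filterᵇ (τ v) (others v T))

  losses : (A → A → Bool) → List A → A → ℕ
  losses τ = wins λ x y → not (τ x y)

  IsTournament : (A → A → Bool) → List A → Set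
  IsTournament τ = AllPairs λ x y → τ y x ≡ not (τ x y)

  private variable
    τ : A → A → Bool

  not-flip : ∀ {T} → IsTournament τ T → IsTournament (λ x y → not (τ x y)) T
  not-flip = AllPairs.map (cong not)

  antisymmetric⇒≢ : ∀ {x y} → τ y x ≡ not (τ x y) → x ≢ y
  antisymmetric⇒≢ {τ} {x} eq refl with τ x x
  antisymmetric⇒≢ () refl | true
  antisymmetric⇒≢ () refl | false

  others-head : ∀ {x X} → All (_≢ x) X → others x (x ∷ X) ≡ X
  others-head {x} x∉X = trans (filter-reject x? λ x≢x → x≢x refl) (filter-all x? x∉X)
    where x? = λ t → ¬? (t ≟ x)

  others-middle : ∀ pre {v} post → All (_≢ v) (pre ++ post) → others v (pre ++ v ∷ post) ≡ pre ++ post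
  others-middle pre {v} post ≢v = begin
    others v (pre ++ v ∷ post)           ≡⟨ filter-++ v? pre (v ∷ post) ⟩
    others v pre ++ others v (v ∷ post)  ≡⟨ cong (others v pre ++_) (filter-reject v? λ v≢v → v≢v refl) ⟩
    others v pre ++ others v post        ≡⟨ filter-++ v? pre post ⟨
    others v (pre ++ post)               ≡⟨ filter-all v? ≢v ⟩
    pre ++ post                          ∎
    where
    open ≡-Reasoning
    v? = λ t → ¬? (t ≟ v)

  wins-∷ : ∀ {x y X} → x ≢ y → wins τ (x ∷ X) y ≡ length (filterᵇ (τ y) [ x ]) + wins τ X y
  wins-∷ {τ} {x} {y} {X} x≢y = begin
    wins τ (x ∷ X) y                           ≡⟨ cong (length ∘ filterᵇ (τ y)) (filter-accept y? x≢y) ⟩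
    length (filterᵇ (τ y) (x ∷ others y X))    ≡⟨ length-filterᵇ-∷ (τ y) x _ ⟩
    length (filterᵇ (τ y) [ x ]) + wins τ X y  ∎
    where
    open ≡-Reasoning
    y? = λ t → ¬? (t ≟ y)

  sum-wins-∷ : ∀ {x X} Y → All (λ y → τ y x ≡ not (τ x y)) Y →
               sum (map (wins τ (x ∷ X)) Y) ≡ length (filterᵇ (not ∘ τ x) Y) + sum (map (wins τ X) Y)
  sum-wins-∷ [] [] = refl
  sum-wins-∷ {τ} {x} {X} (y ∷ Y) (anti ∷ antis) = begin
    wins τ (x ∷ X) y + sum (map (wins τ (x ∷ X)) Y)
      ≡⟨ cong₂ _+_ (wins-∷ {τ} (antisymmetric⇒≢ {τ} anti)) (sum-wins-∷ {τ} Y antis) ⟩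
    (length (filterᵇ (τ y) [ x ]) + wins τ X y) + (loses Y + S)
      ≡⟨ cong (λ c → (c + wins τ X y) + (loses Y + S)) (length-filterᵇ-[] {p = τ y} {not ∘ τ x} anti) ⟩
    (loses [ y ] + wins τ X y) + (loses Y + S)
      ≡⟨ interchange (loses [ y ]) (wins τ X y) (loses Y) S ⟩
    (loses [ y ] + loses Y) + (wins τ X y + S)
      ≡⟨ cong (_+ (wins τ X y + S)) (length-filterᵇ-∷ (not ∘ τ x) y Y) ⟨
    loses (y ∷ Y) + (wins τ X y + S) ∎
    where
    open ≡-Reasoning
    loses = λ Z → length (filterᵇ (not ∘ τ x) Z)
    S = sum (map (wins τ X) Y)

  sum-wins : ∀ {T} → IsTournament τ T → sum (map (wins τ T) T) ≡ length T C 2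
  sum-wins [] = refl
  sum-wins {τ} {x ∷ X} (antis ∷ t) = begin
    wins τ (x ∷ X) x + sum (map (wins τ (x ∷ X)) X)
      ≡⟨ cong₂ _+_ (cong (length ∘ filterᵇ (τ x)) (others-head x∉X)) (sum-wins-∷ {τ} X antis) ⟩
    length (filterᵇ (τ x) X) + (length (filterᵇ (not ∘ τ x) X) + sum (map (wins τ X) X))
      ≡⟨ +-assoc (length (filterᵇ (τ x) X)) _ _ ⟨
    (length (filterᵇ (τ x) X) + length (filterᵇ (not ∘ τ x) X)) + sum (map (wins τ X) X)
      ≡⟨ cong₂ _+_ (trans (sym (length-++ (filterᵇ (τ x) X))) (↭-length (filterᵇ-++-not↭ (τ x) X)))
                   (sum-wins t) ⟩
    length X + length X C 2
      ≡⟨ [1+m]C2≡m+mC2 (length X) ⟨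
    suc (length X) C 2 ∎
    where
    open ≡-Reasoning
    x∉X : All (_≢ x) X
    x∉X = All.map (λ anti → ≢-sym (antisymmetric⇒≢ {τ} anti)) antis

  wins-⊆ : ∀ {S T} v → S ⊆ T → wins τ S v ≤ wins τ T v
  wins-⊆ {τ} v S⊆T = length-mono-≤ (filter⁺ _ _ same (filter⁺ _ _ same S⊆T))
    where
    same : ∀ {P : A → Set} {a b} → a ≡ b → P a → P b
    same refl p = p

  -- The low scorers play C(m, 2) games among themselves and each wins at most k of them.
  few-low-scorers : ∀ {T} k → IsTournament τ T →
                    length (filter (λ v → wins τ T v ≤? k) T) ≤ suc (2 * k)
  few-low-scorers {τ} {T} k t = mC2≤m*k⇒m≤1+2k (length low) k (begin
    length low C 2           ≡⟨ sum-wins (AllPairsᴾ.filter⁺ _ t) ⟨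
    sum (map (wins τ low) low) ≤⟨ sum-map-≤ (All.tabulate few-wins) ⟩
    length low * k           ∎)
    where
    open ≤-Reasoning
    low? = λ v → wins τ T v ≤? k
    low = filter low? T
    few-wins : ∀ {v} → v ∈ low → wins τ low v ≤ k
    few-wins {v} v∈low =
      ≤-trans (wins-⊆ {τ} v (filter-⊆ low? T)) (proj₂ (∈-filter⁻ low? {xs = T} v∈low))

  Central : (A → A → Bool) → List A → ℕ → A → Set
  Central τ T k v = k ≤ wins τ T v × k ≤ losses τ T v

  central? : ∀ τ T k v → Dec (Central τ T k v)
  central? τ T k v = (k ≤? wins τ T v) ×-dec (k ≤? losses τ T v)

  central-exists : ∀ {t ts} k → IsTournament τ (t ∷ ts) → 4 * k ≤ suc (length (t ∷ ts)) →
                   Any (Central τ (t ∷ ts) k) (t ∷ ts)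
  central-exists zero    _ _ = here (z≤n , z≤n)
  central-exists {τ} {t} {ts} (suc k) tour 4k≤ with any? (central? τ (t ∷ ts) (suc k)) (t ∷ ts)
  ... | yes central = central
  ... | no ¬central = ⊥-elim (<⇒≱ (≤-reflexive (arith k)) (≤-trans 4k≤ (s≤s counted)))
    where
    T = t ∷ ts
    low-or-low : ∀ {v} → ¬ Central τ T (suc k) v → wins τ T v ≤ k ⊎ losses τ T v ≤ k
    low-or-low {v} ¬c with wins τ T v ≤? k | losses τ T v ≤? k
    ... | yes w≤k | _       = inj₁ w≤k
    ... | no _    | yes l≤k = inj₂ l≤k
    ... | no w≰k  | no l≰k  = ⊥-elim (¬c (≰⇒> w≰k , ≰⇒> l≰k))
    counted : length T ≤ suc (2 * k) + suc (2 * k)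
    counted = ≤-trans (length-filter-⊎ (λ v → wins τ T v ≤? k) (λ v → losses τ T v ≤? k)
                                       (All.map low-or-low (¬Any⇒All¬ T ¬central)))
                      (+-mono-≤ (few-low-scorers k tour) (few-low-scorers k (not-flip tour)))
    arith : ∀ k → suc (suc (suc (2 * k) + suc (2 * k))) ≡ 4 * suc k
    arith = solve-∀

-- Potential

quad : ℕ → ℕ → ℕ
quad k z = z * (z + 2 * suc k)

potential : ℕ → ℕ → ℕ
potential k m = quad k m / (2 * suc k)

quad-join : ∀ k a b → quad k (suc (a + b)) ≡ 2 * (a * b + a + b + suc k) + 1 + (quad k a + quad k b)
quad-join = expanded where
  expanded : ∀ k a b → suc (a + b) * (suc (a + b) + 2 * suc k) ≡
                       2 * (a * b + a + b + suc k) + 1 + (a * (a + 2 * suc k) + b * (b + 2 * suc k))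
  expanded = solve-∀

quad-superadditive : ∀ k a b → quad k a + quad k b ≤ quad k (suc (a + b))
quad-superadditive k a b =
  ≤-trans (m≤n+m (quad k a + quad k b) (2 * (a * b + a + b + suc k) + 1)) (≤-reflexive (sym (quad-join k a b)))

-- a and b are the sizes of the two sides of a pivot, which hold k sample elements besides x and y
-- unsampled ones; the cross term 2ab of quad pays for comparing those x + y with the pivot.
quad-pivot : ∀ k {a b x y} → k + x ≤ a → k + y ≤ b →
             (x + y) * (2 * suc k) + (quad k a + quad k b) ≤ quad k (suc (a + b))
quad-pivot k {a} {b} {x} {y} k+x≤a k+y≤b = begin
  (x + y) * (2 * suc k) + q                ≡⟨ cong (_+ q) (expand k x y) ⟩
  2 * (x * k + k * y + (x + y)) + q        ≤⟨ +-monoˡ-≤ q (*-monoʳ-≤ 2 bound) ⟩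
  2 * (a * b + a + b) + q                  ≤⟨ +-monoˡ-≤ q (≤-trans (*-monoʳ-≤ 2 (m≤m+n (a * b + a + b) (suc k)))
                                                          (m≤m+n _ 1)) ⟩
  2 * (a * b + a + b + suc k) + 1 + q      ≡⟨ quad-join k a b ⟨
  quad k (suc (a + b))                     ∎
  where
  open ≤-Reasoning
  q = quad k a + quad k b
  expand : ∀ k x y → (x + y) * (2 * suc k) ≡ 2 * (x * k + k * y + (x + y))
  expand = solve-∀
  cross : ∀ k x y → (k + x) * (k + y) ≡ x * k + k * y + (k * k + x * y)
  cross = solve-∀
  bound : x * k + k * y + (x + y) ≤ a * b + a + b
  bound = begin
    x * k + k * y + (x + y)      ≤⟨ +-monoˡ-≤ (x + y) (≤-trans (m≤m+n (x * k + k * y) (k * k + x * y))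
                                                               (≤-reflexive (sym (cross k x y)))) ⟩
    (k + x) * (k + y) + (x + y)  ≤⟨ +-mono-≤ (*-mono-≤ k+x≤a k+y≤b)
                                            (+-mono-≤ (m+n≤o⇒n≤o k k+x≤a) (m+n≤o⇒n≤o k k+y≤b)) ⟩
    a * b + (a + b)              ≡⟨ +-assoc (a * b) a b ⟨
    a * b + a + b                ∎

/-superadditive : ∀ a b d .{{_ : NonZero d}} → a / d + b / d ≤ (a + b) / d
/-superadditive a b d = begin
  a / d + b / d                ≡⟨ m*n/n≡m (a / d + b / d) d ⟨
  (a / d + b / d) * d / d      ≤⟨ /-monoˡ-≤ d (≤-trans (≤-reflexive (*-distribʳ-+ d (a / d) _))
                                                   (+-mono-≤ (m/n*n≤m a d) (m/n*n≤m b d))) ⟩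
  (a + b) / d                  ∎
  where open ≤-Reasoning

potential-join : ∀ k {r a b m} → r * (2 * suc k) + (quad k a + quad k b) ≤ quad k m →
                 r + (potential k a + potential k b) ≤ potential k m
potential-join k {r} {a} {b} {m} h = begin
  r + (quad k a / D + quad k b / D)      ≤⟨ +-monoʳ-≤ r (/-superadditive (quad k a) _ D) ⟩
  r + (quad k a + quad k b) / D          ≡⟨ cong (_+ _) (m*n/n≡m r D) ⟨
  r * D / D + (quad k a + quad k b) / D  ≡⟨ +-distrib-/-∣ˡ (quad k a + quad k b) (divides-refl r) ⟨
  (r * D + (quad k a + quad k b)) / D    ≤⟨ /-monoˡ-≤ D h ⟩
  quad k m / D                           ∎
  where
  open ≤-Reasoning
  D = 2 * suc k

potential-pivot : ∀ k {tb rb ta ra r} → rb + ra ≡ r → r ≡ 0 ⊎ (k ≤ tb × k ≤ ta) →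
                  r + (potential k (tb + rb) + potential k (ta + ra)) ≤ potential k (suc (tb + rb + (ta + ra)))
potential-pivot k {tb} {rb} {ta} {ra} _    (inj₁ refl) =
  potential-join k {0} {tb + rb} {ta + ra} {suc (tb + rb + (ta + ra))}
    (quad-superadditive k (tb + rb) (ta + ra))
potential-pivot k {tb} {rb} {ta} {ra} refl (inj₂ (k≤tb , k≤ta)) =
  potential-join k {rb + ra} {tb + rb} {ta + ra} {suc (tb + rb + (ta + ra))}
    (quad-pivot k (+-monoˡ-≤ rb k≤tb) (+-monoˡ-≤ ra k≤ta))

budget-split : ∀ s′ {pa pb pm rb ra r} q → rb + ra ≡ r → r + (pa + pb) ≤ pm →
               (pa + suc s′ * rb) + ((pb + suc s′ * ra) + q) ≤ s′ * r + (pm + q)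
budget-split s′ {pa} {pb} {pm} {rb} {ra} q refl h = begin
  (pa + suc s′ * rb) + ((pb + suc s′ * ra) + q) ≡⟨ regroup s′ pa pb rb ra q ⟩
  s′ * (rb + ra) + ((rb + ra + (pa + pb)) + q)  ≤⟨ +-monoʳ-≤ (s′ * (rb + ra)) (+-monoˡ-≤ q h) ⟩
  s′ * (rb + ra) + (pm + q)                     ∎
  where
  open ≤-Reasoning
  regroup : ∀ s′ pa pb rb ra q → (pa + suc s′ * rb) + ((pb + suc s′ * ra) + q) ≡
                                 s′ * (rb + ra) + ((rb + ra + (pa + pb)) + q)
  regroup = solve-∀

-- The algorithm

-- τ x y = true records the answer x ≥ y.
Table : ℕ → Set
Table n = Fin n → Fin n → Bool

set : Table n → Fin n → Fin n → Bool → Table n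
set τ x y b a c = if does (a ≟ x) ∧ does (c ≟ y) then b else τ a c

record-answer : Table n → Fin n → Fin n → Bool → Table n
record-answer τ x y b = set (set τ x y b) y x (not b)

set-hit : ∀ (τ : Table n) x y b → set τ x y b x y ≡ b
set-hit τ x y b rewrite dec-true (x ≟ x) refl | dec-true (y ≟ y) refl = refl

set-miss : ∀ (τ : Table n) {x y} b {a c} → a ≢ x ⊎ c ≢ y → set τ x y b a c ≡ τ a c
set-miss τ {x} {y} b {a} {c} (inj₁ a≢x) rewrite dec-false (a ≟ x) a≢x = refl
set-miss τ {x} {y} b {a} {c} (inj₂ c≢y) rewrite dec-false (c ≟ y) c≢y | ∧-zeroʳ (does (a ≟ x)) = refl

answer-xy : ∀ (τ : Table n) {x y} b → x ≢ y → record-answer τ x y b x y ≡ b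
answer-xy τ {x} {y} b x≢y = trans (set-miss (set τ x y b) (not b) (inj₁ x≢y)) (set-hit τ x y b)

answer-yx : ∀ (τ : Table n) x y b → record-answer τ x y b y x ≡ not b
answer-yx τ x y b = set-hit (set τ x y b) y x (not b)

answer-miss : ∀ (τ : Table n) {x y} b {a c} → a ≢ x ⊎ c ≢ y → a ≢ y ⊎ c ≢ x →
              record-answer τ x y b a c ≡ τ a c
answer-miss τ {x} {y} b miss miss′ = trans (set-miss (set τ x y b) (not b) miss′) (set-miss τ b miss)

open module FinTournament {n} = Tournament (_≟_ {n})

-- A subproblem consists of a sample T, all of whose pairs have been compared and recorded in the
-- table, and the rest R, which has not been compared with anything yet.
module Sorting (k : ℕ) {n : ℕ} where

  sampleSize : ℕ
  sampleSize = suc (4 * k)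

  insert : Table n → Fin n → List (Fin n) → Query n (Table n)
  insert τ x []       = pure τ
  insert τ x (y ∷ ys) = query x y λ b → insert τ x ys >>= λ τ′ → pure (record-answer τ′ x y b)

  record Grown (T R : List (Fin n)) : Set where
    constructor grown
    field
      table     : Table n
      sample    : List (Fin n)
      rest      : List (Fin n)
      regrouped : sample ++ rest ↭ T ++ R

  moved : ∀ {x T R} → Grown (x ∷ T) R → Grown T (x ∷ R)
  moved {x} {T} {R} (grown τ T′ R′ e) = grown τ T′ R′ (↭-trans e (↭-sym (shift x T R)))

  grow : Table n → (T R : List (Fin n)) → Query n (Grown T R)
  grow τ T []      = pure (grown τ T [] ↭-refl)
  grow τ T (x ∷ R) with length T <? sampleSize
  ... | yes _ = insert τ x T >>= λ τ′ → grow τ′ (x ∷ T) R >>= λ g → pure (moved g)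
  ... | no _  = pure (grown τ T (x ∷ R) ↭-refl)

  record Split (R : List (Fin n)) : Set where
    constructor split
    field
      below     : List (Fin n)
      above     : List (Fin n)
      regrouped : below ++ above ↭ R

  place : Bool → ∀ r {R} → Split R → Split (r ∷ R)
  place true  r (split B A e) = split (r ∷ B) A (prep r e)
  place false r (split B A e) = split B (r ∷ A) (↭-trans (shift r B A) (prep r e))

  partition : Fin n → (R : List (Fin n)) → Query n (Split R)
  partition v []      = pure (split [] [] ↭-refl)
  partition v (r ∷ R) = query v r λ b → partition v R >>= λ p → pure (place b r p)

  pivot : Table n → (t : Fin n) (ts : List (Fin n)) → ∃[ v ] v ∈ t ∷ ts
  pivot τ t ts with any? (central? τ (t ∷ ts) k) (t ∷ ts)
  ... | yes c = let v , v∈ , _ = find c in v , v∈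
  ... | no _  = t , here refl

  pivot-central : ∀ τ t ts → Any (Central τ (t ∷ ts) k) (t ∷ ts) →
                  Central τ (t ∷ ts) k (proj₁ (pivot τ t ts))
  pivot-central τ t ts some with any? (central? τ (t ∷ ts) k) (t ∷ ts)
  ... | yes c  = proj₂ (proj₂ (find c))
  ... | no ¬c  = ⊥-elim (¬c some)

  record Ordering (T R : List (Fin n)) : Set where
    constructor ordering
    field
      order  : List (Fin n)
      order↭ : order ↭ T ++ R

  lower upper : Table n → Fin n → List (Fin n) → List (Fin n)
  lower τ v = filterᵇ (τ v)
  upper τ v = filterᵇ (not ∘ τ v)

  regroup-↭ : ∀ τ pre v post {R′ RB RA} → RB ++ RA ↭ R′ →
              v ∷ (lower τ v (pre ++ post) ++ RB) ++ (upper τ v (pre ++ post) ++ RA) ↭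
              (pre ++ v ∷ post) ++ R′
  regroup-↭ τ pre v post {R′} {RB} {RA} eR = begin
    v ∷ (lower τ v O ++ RB) ++ (upper τ v O ++ RA)  ↭⟨ prep v (↭-interchange (lower τ v O) RB _ RA) ⟩
    v ∷ (lower τ v O ++ upper τ v O) ++ (RB ++ RA)  ↭⟨ prep v (++⁺ (filterᵇ-++-not↭ (τ v) O) eR) ⟩
    v ∷ O ++ R′                                      ↭⟨ ++⁺ʳ R′ (shift v pre post) ⟨
    (pre ++ v ∷ post) ++ R′                          ∎
    where
    open PermutationReasoning
    O = pre ++ post

  mutual
    sort : ℕ → Table n → (T R : List (Fin n)) → Query n (Ordering T R)
    sort zero    τ T R = pure (ordering (T ++ R) ↭-refl)  -- unreachable: the fuel exceeds |T| + |R|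
    sort (suc f) τ T R = grow τ T R >>= sortGrown f

    sortGrown : ∀ {T R} → ℕ → Grown T R → Query n (Ordering T R)
    sortGrown f (grown τ []       R′ e) = pure (ordering R′ e)
    sortGrown f (grown τ (t ∷ ts) R′ e) =
      let v , v∈ = pivot τ t ts
          pre , post , split-at-v = ∈-∃++ v∈
      in  sortAround f τ e pre v post split-at-v

    sortAround : ∀ {T R T′ R′} → ℕ → Table n → T′ ++ R′ ↭ T ++ R →
                 ∀ pre v post → T′ ≡ pre ++ [ v ] ++ post → Query n (Ordering T R)
    sortAround {R′ = R′} f τ e pre v post refl = partition v R′ >>= sortSides f τ pre v post e

    sortSides : ∀ {T R R′} → ℕ → Table n → ∀ pre v post → (pre ++ v ∷ post) ++ R′ ↭ T ++ R →
                Split R′ → Query n (Ordering T R)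
    sortSides {T} {R} {R′} f τ pre v post e (split RB RA eR) =
      sort f τ TB RB >>= λ lb →
      sort f τ TA RA >>= λ la →
      pure (ordering (order lb ++ v ∷ order la) (begin
        order lb ++ v ∷ order la         ↭⟨ shift v (order lb) (order la) ⟩
        v ∷ order lb ++ order la         ↭⟨ prep v (++⁺ (order↭ lb) (order↭ la)) ⟩
        v ∷ (TB ++ RB) ++ (TA ++ RA)     ↭⟨ regroup-↭ τ pre v post eR ⟩
        (pre ++ v ∷ post) ++ R′          ↭⟨ e ⟩
        T ++ R                           ∎))
      where
      open PermutationReasoning
      open Ordering
      TB = lower τ v (pre ++ post)
      TA = upper τ v (pre ++ post)

  sortAll : Query n (Permutation′ n)
  sortAll = sort n (λ _ _ → true) [] (allFin n) >>= λ o →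
            pure (listPermutation (Ordering.order o) (Ordering.order↭ o))

module Correctness {n : ℕ} (val : Fin n → ℚ) (k : ℕ) where

  open Sorting k {n}
  open Ordering

  record Answered (τ : Table n) (x y : Fin n) : Set where
    constructor answered
    field
      antisymmetric : τ y x ≡ not (τ x y)
      admissible    : Admissible val x y (τ x y)

  Recorded : Table n → List (Fin n) → Set
  Recorded τ T = ∀ {x y} → x ∈ T → y ∈ T → x ≢ y → Answered τ x y

  Admissible-flip : ∀ {x y} b → Admissible val x y b → Admissible val y x (not b)
  Admissible-flip true  adm = adm
  Admissible-flip false adm = adm

  Answered-flip : ∀ {τ x y} → Answered τ x y → Answered τ y x
  Answered-flip {τ} {x} {y} (answered anti adm) = answered
    (sym (trans (cong not anti) (not-involutive (τ x y))))
    (subst (Admissible val y x) (sym anti) (Admissible-flip (τ x y) adm))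

  Answered-cong : ∀ {τ τ′ x y} → τ′ x y ≡ τ x y → τ′ y x ≡ τ y x →
                  Answered τ x y → Answered τ′ x y
  Answered-cong {x = x} {y} xy yx (answered anti adm) =
    answered (trans yx (trans anti (cong not (sym xy)))) (subst (Admissible val x y) (sym xy) adm)

  Recorded-⊆ : ∀ {τ S T} → (∀ {x} → x ∈ S → x ∈ T) → Recorded τ T → Recorded τ S
  Recorded-⊆ S⊆T rec x∈S y∈S = rec (S⊆T x∈S) (S⊆T y∈S)

  Recorded⇒IsTournament : ∀ {τ T} → Unique T → Recorded τ T → IsTournament τ T
  Recorded⇒IsTournament []         rec = []
  Recorded⇒IsTournament (x≢ ∷ uniq) rec =
    All.tabulate (λ y∈ → Answered.antisymmetric (rec (here refl) (there y∈) (All.lookup x≢ y∈))) ∷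
    Recorded⇒IsTournament uniq (λ x∈ y∈ → rec (there x∈) (there y∈))

  record Inserted (τ τ′ : Table n) (x : Fin n) (T : List (Fin n)) : Set where
    constructor inserted
    field
      answers   : All (Answered τ′ x) T
      unchanged : ∀ {a c} → a ≢ x → c ≢ x → τ′ a c ≡ τ a c

  Inserted-∷ : ∀ {τ τ′ x y ys b} → x ≢ y → All (x ≢_) ys → All (y ≢_) ys → Admissible val x y b →
               Inserted τ τ′ x ys → Inserted τ (record-answer τ′ x y b) x (y ∷ ys)
  Inserted-∷ {τ} {τ′} {x} {y} {ys} {b} x≢y x∉ys y∉ys adm (inserted ans same) = inserted
    (new ∷ All.tabulate (λ z∈ → kept (All.lookup x∉ys z∈) (All.lookup y∉ys z∈) (All.lookup ans z∈)))
    same′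
    where
    new : Answered (record-answer τ′ x y b) x y
    new = answered (trans (answer-yx τ′ x y b) (cong not (sym (answer-xy τ′ b x≢y))))
                   (subst (Admissible val x y) (sym (answer-xy τ′ b x≢y)) adm)
    kept : ∀ {z} → x ≢ z → y ≢ z → Answered τ′ x z → Answered (record-answer τ′ x y b) x z
    kept x≢z y≢z = Answered-cong (answer-miss τ′ b (inj₂ (≢-sym y≢z)) (inj₁ x≢y))
                                     (answer-miss τ′ b (inj₁ (≢-sym x≢z)) (inj₁ (≢-sym y≢z)))
    same′ : ∀ {a c} → a ≢ x → c ≢ x → record-answer τ′ x y b a c ≡ τ a c
    same′ a≢x c≢x = trans (answer-miss τ′ b (inj₁ a≢x) (inj₂ c≢x)) (same a≢x c≢x)

  insert-spec : ∀ τ x T r → All (x ≢_) T → Unique T →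
                Runs val (insert τ x T) (length T + r) (λ τ′ e → Inserted τ τ′ x T × r ≤ e)
  insert-spec τ x []       r _             _              = inserted [] (λ _ _ → refl) , ≤-refl
  insert-spec τ x (y ∷ ys) r (x≢y ∷ x∉ys) (y∉ys ∷ uniq) b adm =
    Runs-bind (insert τ x ys) (insert-spec τ x ys r x∉ys uniq)
      λ τ′ e (ins , r≤e) → Inserted-∷ x≢y x∉ys y∉ys adm ins , r≤e

  Recorded-insert : ∀ {τ τ′ x T} → All (x ≢_) T → Recorded τ T → Inserted τ τ′ x T →
                    Recorded τ′ (x ∷ T)
  Recorded-insert x∉T rec ins               (here refl) (here refl) x≢x = ⊥-elim (x≢x refl)
  Recorded-insert x∉T rec (inserted ans _)  (here refl) (there y∈)  _   = All.lookup ans y∈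
  Recorded-insert x∉T rec (inserted ans _)  (there a∈)  (here refl) _   = Answered-flip (All.lookup ans a∈)
  Recorded-insert x∉T rec (inserted _ same) (there a∈)  (there c∈)  a≢c =
    Answered-cong (same (≢-sym (All.lookup x∉T a∈)) (≢-sym (All.lookup x∉T c∈)))
                  (same (≢-sym (All.lookup x∉T c∈)) (≢-sym (All.lookup x∉T a∈)))
                  (rec a∈ c∈ a≢c)

  GrownInvariant : ∀ {T R} → Grown T R → Set
  GrownInvariant (grown τ T′ R′ _) =
    Recorded τ T′ × Unique (T′ ++ R′) × (R′ ≡ [] ⊎ sampleSize ≤ length T′)

  grow-spec : ∀ τ T R r → Recorded τ T → Unique (T ++ R) →
              Runs val (grow τ T R) (sampleSize * length R + r)
                   (λ g e → GrownInvariant g × sampleSize * length (Grown.rest g) + r ≤ e)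
  grow-spec τ T []      r rec uniq = (rec , uniq , inj₁ refl) , ≤-refl
  grow-spec τ T (x ∷ R) r rec uniq with length T <? sampleSize
  ... | no T≮s = (rec , uniq , inj₂ (≮⇒≥ T≮s)) , ≤-refl
  ... | yes T<s =
    Runs-bind (insert τ x T) (Runs-≤ (insert τ x T) insert-budget (insert-spec τ x T r′ x∉T uniqT))
      λ τ′ e (ins , r′≤e) →
        Runs-bind (grow τ′ (x ∷ T) R)
          (Runs-≤ (grow τ′ (x ∷ T) R) r′≤e
                  (grow-spec τ′ (x ∷ T) R r (Recorded-insert x∉T rec ins) uniq′))
          λ _ _ ok → ok
    where
    r′ = sampleSize * length R + r
    uniq′ : Unique ((x ∷ T) ++ R)
    uniq′ = Unique-resp-↭ (shift x T R) uniq
    x∉T : All (x ≢_) T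
    x∉T = All-++⁻ˡ T (AllPairs.head uniq′)
    uniqT : Unique T
    uniqT = proj₁ (AllPairs-++⁻ T uniq)
    insert-budget : length T + r′ ≤ sampleSize * length (x ∷ R) + r
    insert-budget = begin
      length T + (sampleSize * length R + r)       ≤⟨ +-monoˡ-≤ _ (<⇒≤ T<s) ⟩
      sampleSize + (sampleSize * length R + r)     ≡⟨ +-assoc sampleSize _ r ⟨
      sampleSize + sampleSize * length R + r       ≡⟨ cong (_+ r) (*-suc sampleSize (length R)) ⟨
      sampleSize * length (x ∷ R) + r              ∎
      where open ≤-Reasoning

  SplitAdmissible : Fin n → ∀ {R} → Split R → Set
  SplitAdmissible v (split B A _) =
    All (λ b → Admissible val v b true) B × All (λ a → Admissible val v a false) A

  place-admissible : ∀ {v r R} b → Admissible val v r b → (p : Split R) →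
                     SplitAdmissible v p → SplitAdmissible v (place b r p)
  place-admissible true  adm (split B A _) (okB , okA) = adm ∷ okB , okA
  place-admissible false adm (split B A _) (okB , okA) = okB , adm ∷ okA

  partition-spec : ∀ v R r → Runs val (partition v R) (length R + r) (λ p e → SplitAdmissible v p × r ≤ e)
  partition-spec v []      r = ([] , []) , ≤-refl
  partition-spec v (x ∷ R) r b adm =
    Runs-bind (partition v R) (partition-spec v R r) λ p e (ok , r≤e) → place-admissible b adm p ok , r≤e

  pivot-side : ∀ {τ} pre v post (q : Fin n → Bool) b → (∀ {x} → Bool.T (q x) → τ v x ≡ b) →
              Recorded τ (pre ++ v ∷ post) → All (_≢ v) (pre ++ post) →
              Recorded τ (filterᵇ q (pre ++ post)) × All (λ x → Admissible val v x b) (filterᵇ q (pre ++ post))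
  pivot-side {τ} pre v post q b q⇒b rec ≢v =
    Recorded-⊆ (skip ∘ proj₁ ∘ ∈-filter⁻ (T? ∘ q)) rec , All.tabulate admissible
    where
    skip : ∀ {x} → x ∈ pre ++ post → x ∈ pre ++ v ∷ post
    skip x∈ with ∈-++⁻ pre x∈
    ... | inj₁ x∈pre  = ∈-++⁺ˡ x∈pre
    ... | inj₂ x∈post = ∈-++⁺ʳ pre (there x∈post)
    admissible : ∀ {x} → x ∈ filterᵇ q (pre ++ post) → Admissible val v x b
    admissible {x} x∈ =
      let x∈O , qx = ∈-filter⁻ (T? ∘ q) {xs = pre ++ post} x∈
      in  subst (Admissible val v x) (q⇒b qx)
                (Answered.admissible (rec (∈-insert pre) (skip x∈O) (≢-sym (All.lookup ≢v x∈O))))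

  -- Each element of R carries sampleSize queries for its eventual insertion into a sample;
  -- partitioning is paid for by the drop in potential.
  cost : List (Fin n) → List (Fin n) → ℕ
  cost T R = potential k (length T + length R) + sampleSize * length R

  SortedLeaving : ∀ {T R} → ℕ → Ordering T R → ℕ → Set
  SortedLeaving r o e = AlmostSorted val (order o) × r ≤ e

  mutual
    sort-spec : ∀ f τ T R r → length T + length R ≤ f → Recorded τ T → Unique (T ++ R) →
                Runs val (sort f τ T R) (cost T R + r) (SortedLeaving r)
    sort-spec zero    τ []      []      r _  _ _ = [] , m≤n+m r (cost [] [])
    sort-spec zero    τ []      (_ ∷ _) r () _ _
    sort-spec zero    τ (_ ∷ _) _       r () _ _
    sort-spec (suc f) τ T R r size rec uniq =
      Runs-bind (grow τ T R)
        (Runs-≤ (grow τ T R) (≤-reflexive (rotate (sampleSize * length R) _ r))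
                (grow-spec τ T R (potential k (length T + length R) + r) rec uniq))
        λ g _ (ok , le) → sortGrown-spec f g r size ok le
      where
      rotate : ∀ a b c → a + (b + c) ≡ b + a + c
      rotate = solve-∀

    sortGrown-spec : ∀ {T R} f (g : Grown T R) r {b} → length T + length R ≤ suc f → GrownInvariant g →
                     sampleSize * length (Grown.rest g) + (potential k (length T + length R) + r) ≤ b →
                     Runs val (sortGrown f g) b (SortedLeaving r)
    sortGrown-spec f (grown τ [] R′ _) r _ (_ , _ , inj₁ refl) le =
      [] , ≤-trans (m≤n+m r _) (≤-trans (m≤n+m _ (sampleSize * 0)) le)
    sortGrown-spec f (grown τ [] R′ _) r _ (_ , _ , inj₂ ())   le
    sortGrown-spec {T} {R} f (grown τ (t ∷ ts) R′ e) r {b} size (rec , uniq , full) le =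
      sortAround-spec {T} {R} f τ e pre v post split-at-v r (subst (_≤ suc f) same-size size) rec uniq balanced
        (subst (λ m → sampleSize * length R′ + (potential k m + r) ≤ b) same-size le)
      where
      v = proj₁ (pivot τ t ts)
      pre = proj₁ (∈-∃++ (proj₂ (pivot τ t ts)))
      post = proj₁ (proj₂ (∈-∃++ (proj₂ (pivot τ t ts))))
      split-at-v = proj₂ (proj₂ (∈-∃++ (proj₂ (pivot τ t ts))))
      same-size : length T + length R ≡ length (t ∷ ts) + length R′
      same-size = trans (sym (length-++ T)) (trans (sym (↭-length e)) (length-++ (t ∷ ts)))
      balanced : R′ ≡ [] ⊎ Central τ (t ∷ ts) k v
      balanced = Sum.map₂ (λ full′ → pivot-central τ t ts (central-exists k
                             (Recorded⇒IsTournament (proj₁ (AllPairs-++⁻ (t ∷ ts) uniq)) rec)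
                             (≤-trans (n≤1+n (4 * k)) (m≤n⇒m≤1+n full′))))
                          full

    sortAround-spec : ∀ {T R T′ R′} f τ (e : T′ ++ R′ ↭ T ++ R) pre v post
                      (split-at-v : T′ ≡ pre ++ [ v ] ++ post) r {b} →
                      length T′ + length R′ ≤ suc f → Recorded τ T′ → Unique (T′ ++ R′) →
                      R′ ≡ [] ⊎ Central τ T′ k v →
                      sampleSize * length R′ + (potential k (length T′ + length R′) + r) ≤ b →
                      Runs val (sortAround {T} {R} f τ e pre v post split-at-v) b (SortedLeaving r)
    sortAround-spec {T} {R} {T′} {R′} f τ e pre v post refl r size rec uniq balanced le =
      Runs-bind (partition v R′)
        (Runs-≤ (partition v R′) (≤-trans (≤-reflexive (sym (+-assoc (length R′) _ _))) le)
                (partition-spec v R′ r′))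
        λ p _ (ok , r′≤) → sortSides-spec {T} {R} f τ pre v post e p r size rec uniq balanced ok r′≤
      where
      r′ = 4 * k * length R′ + (potential k (length T′ + length R′) + r)

    sortSides-spec : ∀ {T R R′} f τ pre v post (e : (pre ++ v ∷ post) ++ R′ ↭ T ++ R)
                     (p : Split R′) r {b} →
                     length (pre ++ v ∷ post) + length R′ ≤ suc f → Recorded τ (pre ++ v ∷ post) →
                     Unique ((pre ++ v ∷ post) ++ R′) → R′ ≡ [] ⊎ Central τ (pre ++ v ∷ post) k v →
                     SplitAdmissible v p →
                     4 * k * length R′ + (potential k (length (pre ++ v ∷ post) + length R′) + r) ≤ b →
                     Runs val (sortSides {T} {R} f τ pre v post e p) b (SortedLeaving r)
    sortSides-spec {T} {R} {R′} f τ pre v post e (split RB RA eR) r size rec uniq balanced (okB , okA) le =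
      Runs-bind (sort f τ TB RB)
        (Runs-≤ (sort f τ TB RB) (≤-trans budget le) (sort-spec f τ TB RB (cost TA RA + r) fuelB recB uniqB))
        λ lb _ (sortedB , le′) →
      Runs-bind (sort f τ TA RA) (Runs-≤ (sort f τ TA RA) le′ (sort-spec f τ TA RA r fuelA recA uniqA))
        λ la _ (sortedA , r≤) →
      AlmostSorted-around sortedB sortedA (All-resp-↭ (↭-sym (order↭ lb)) (All-++⁺ admB okB))
                                          (All-resp-↭ (↭-sym (order↭ la)) (All-++⁺ admA okA)) , r≤
      where
      T′ = pre ++ v ∷ post
      O = pre ++ post
      TB = lower τ v O
      TA = upper τ v O
      v∉O : All (_≢ v) O
      v∉O = All.map ≢-sym (AllPairs.head (Unique-resp-↭ (shift v pre post)
                                                        (proj₁ (AllPairs-++⁻ T′ uniq))))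
      recB = proj₁ (pivot-side pre v post (τ v) true (Equivalence.to T-≡) rec v∉O)
      admB = proj₂ (pivot-side pre v post (τ v) true (Equivalence.to T-≡) rec v∉O)
      recA = proj₁ (pivot-side pre v post (not ∘ τ v) false (Equivalence.to T-not-≡) rec v∉O)
      admA = proj₂ (pivot-side pre v post (not ∘ τ v) false (Equivalence.to T-not-≡) rec v∉O)
      uniq′ : Unique (v ∷ (TB ++ RB) ++ (TA ++ RA))
      uniq′ = Unique-resp-↭ (↭-sym (regroup-↭ τ pre v post eR)) uniq
      uniqB = proj₁ (AllPairs-++⁻ (TB ++ RB) (AllPairs.tail uniq′))
      uniqA = proj₂ (AllPairs-++⁻ (TB ++ RB) (AllPairs.tail uniq′))
      sizes : suc (length TB + length RB + (length TA + length RA)) ≡ length T′ + length R′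
      sizes = begin
        suc (length TB + length RB + (length TA + length RA))
          ≡⟨ cong suc (cong₂ _+_ (length-++ TB) (length-++ TA)) ⟨
        suc (length (TB ++ RB) + length (TA ++ RA))
          ≡⟨ cong suc (length-++ (TB ++ RB)) ⟨
        length (v ∷ (TB ++ RB) ++ (TA ++ RA))
          ≡⟨ ↭-length (regroup-↭ τ pre v post eR) ⟩
        length (T′ ++ R′)
          ≡⟨ length-++ T′ ⟩
        length T′ + length R′ ∎
        where open ≡-Reasoning
      fuel : length TB + length RB + (length TA + length RA) ≤ f
      fuel = s≤s⁻¹ (subst (_≤ suc f) (sym sizes) size)
      fuelB = ≤-trans (m≤m+n (length TB + length RB) (length TA + length RA)) fuel
      fuelA = ≤-trans (m≤n+m (length TA + length RA) (length TB + length RB)) fuel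
      RB+RA : length RB + length RA ≡ length R′
      RB+RA = trans (sym (length-++ RB)) (↭-length eR)
      central-sides : length R′ ≡ 0 ⊎ (k ≤ length TB × k ≤ length TA)
      central-sides = Sum.map (cong length) (Product.map
        (subst (k ≤_) (cong (length ∘ filterᵇ (τ v)) (others-middle pre post v∉O)))
        (subst (k ≤_) (cong (length ∘ filterᵇ (not ∘ τ v)) (others-middle pre post v∉O)))) balanced
      budget : cost TB RB + (cost TA RA + r) ≤ 4 * k * length R′ + (potential k (length T′ + length R′) + r)
      budget = budget-split (4 * k) {potential k a} {potential k b} r RB+RA
                 (subst (λ m → length R′ + (potential k a + potential k b) ≤ potential k m) sizes
                        (potential-pivot k RB+RA central-sides))
        where
        a = length TB + length RB
        b = length TA + length RA


-- Choice of parameters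

interval : ∀ (g : ℕ → ℕ) → (∀ i → g i < g (suc i)) → ∀ {n} → g 0 ≤ n →
           ∃[ i ] g i ≤ n × n < g (suc i)
interval g increasing {zero}  g0≤n = 0 , g0≤n , ≤-trans (s≤s z≤n) (increasing 0)
interval g increasing {suc n} g0≤n with g 0 ≤? n
... | no g0≰n = 0 , g0≤n , ≤-<-trans (≰⇒> g0≰n) (increasing 0)
... | yes g0≤n' with interval g increasing g0≤n'
...   | i , gi≤n , n<gi+1 with g (suc i) ≤? suc n
...     | yes gi+1≤n = suc i , gi+1≤n , ≤-<-trans n<gi+1 (increasing (suc i))
...     | no gi+1≰n  = i , m≤n⇒m≤1+n gi≤n , ≰⇒> gi+1≰n

threshold : ℕ → ℕ
threshold i = suc i * suc (2 * i)

threshold-increasing : ∀ i → threshold i < threshold (suc i)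
threshold-increasing i = <-≤-trans (m<m+n (threshold i) (s≤s z≤n)) (≤-reflexive (grow i))
  where
  grow : ∀ i → suc i * suc (2 * i) + suc (4 * i + 4) ≡ suc (suc i) * suc (2 * suc i)
  grow = solve-∀

-- For K = k + 1 this makes n ≈ 2K², so the budget n² / 2K + (4K - 2) n is about 3.5 n^(3/2).
cost-bound : ∀ k {n} → threshold k ≤ n → n < threshold (suc k) →
             (potential k n + suc (4 * k) * n) * (potential k n + suc (4 * k) * n) ≤ 16 * n ^ 3
cost-bound k {n} lo hi = *-cancelˡ-≤ (D * D) (begin
  D * D * (d * d)                 ≡⟨ regroup D d ⟩
  (d * D) * (d * D)               ≤⟨ *-mono-≤ scaled scaled ⟩
  (n * (n + y)) * (n * (n + y))   ≡⟨ regroup′ n (n + y) ⟩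
  n * n * ((n + y) * (n + y))     ≤⟨ *-monoʳ-≤ (n * n) square ⟩
  n * n * (8 * (y * n))           ≡⟨ regroup″ n y ⟩
  8 * y * n ^ 3                   ≤⟨ *-monoˡ-≤ (n ^ 3) coefficient ⟩
  16 * (D * D) * n ^ 3            ≡⟨ regroup‴ D (n ^ 3) ⟩
  D * D * (16 * n ^ 3)            ∎)
  where
  open ≤-Reasoning
  D = 2 * suc k
  y = 4 * threshold k
  d = potential k n + suc (4 * k) * n
  regroup : ∀ D d → D * D * (d * d) ≡ (d * D) * (d * D)
  regroup = solve-∀
  regroup′ : ∀ a b → (a * b) * (a * b) ≡ a * a * (b * b)
  regroup′ = solve-∀
  regroup″ : ∀ n y → n * n * (8 * (y * n)) ≡ 8 * y * (n * (n * (n * 1)))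
  regroup″ = solve-∀
  regroup‴ : ∀ D m → 16 * (D * D) * m ≡ D * D * (16 * m)
  regroup‴ = solve-∀
  budget : ∀ k n → n * (n + 2 * suc k) + suc (4 * k) * n * (2 * suc k) ≡ n * (n + 4 * (suc k * suc (2 * k)))
  budget = solve-∀
  scaled : d * D ≤ n * (n + y)
  scaled = begin
    d * D                                         ≡⟨ *-distribʳ-+ D (potential k n) _ ⟩
    potential k n * D + suc (4 * k) * n * D       ≤⟨ +-monoˡ-≤ _ (m/n*n≤m (quad k n) D) ⟩
    quad k n + suc (4 * k) * n * D                ≡⟨ budget k n ⟩
    n * (n + y)                                   ∎
  y≤4n : y ≤ 4 * n
  y≤4n = *-monoʳ-≤ 4 lo
  n≤2y : n ≤ 2 * y
  n≤2y = ≤-trans (<⇒≤ hi) (≤-trans (m≤m+n _ (14 * k * k + 17 * k + 2)) (≤-reflexive (spread k)))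
    where
    spread : ∀ k → suc (suc k) * suc (2 * suc k) + (14 * k * k + 17 * k + 2) ≡ 2 * (4 * (suc k * suc (2 * k)))
    spread = solve-∀
  square : (n + y) * (n + y) ≤ 8 * (y * n)
  square = begin
    (n + y) * (n + y)               ≡⟨ expand n y ⟩
    n * n + y * y + 2 * (n * y)     ≤⟨ +-monoˡ-≤ _ (+-mono-≤ (*-monoʳ-≤ n n≤2y) (*-monoʳ-≤ y y≤4n)) ⟩
    n * (2 * y) + y * (4 * n) + 2 * (n * y) ≡⟨ collect n y ⟩
    8 * (y * n)                     ∎
    where
    expand : ∀ n y → (n + y) * (n + y) ≡ n * n + y * y + 2 * (n * y)
    expand = solve-∀
    collect : ∀ n y → n * (2 * y) + y * (4 * n) + 2 * (n * y) ≡ 8 * (y * n)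
    collect = solve-∀
  coefficient : 8 * y ≤ 16 * (D * D)
  coefficient = ≤-trans (m≤m+n (8 * y) (32 * suc k)) (≤-reflexive (squareK k))
    where
    squareK : ∀ k → 8 * (4 * (suc k * suc (2 * k))) + 32 * suc k ≡ 16 * (2 * suc k * (2 * suc k))
    squareK = solve-∀

sortAll-sortsWithin : ∀ k {n} (val : Fin n → ℚ) →
                      SortsWithin val (toAlg (Sorting.sortAll k)) (potential k n + suc (4 * k) * n)
sortAll-sortsWithin k {n} val = toAlg-sortsWithin sortAll
  (Runs-bind (sort n (λ _ _ → true) [] (allFin n))
    (subst (λ d → Runs val (sort n (λ _ _ → true) [] (allFin n)) d (SortedLeaving 0)) budget
      (sort-spec n (λ _ _ → true) [] (allFin n) 0 (≤-reflexive (length-allFin n)) (λ ()) (allFin⁺ n)))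
    λ o _ (sorted , _) → listPermutation-error (Sorting.Ordering.order o) (Sorting.Ordering.order↭ o) sorted)
  where
  open Sorting k {n}
  open Correctness val k
  budget : cost [] (allFin n) + 0 ≡ potential k n + suc (4 * k) * n
  budget = trans (+-identityʳ _) (cong (λ m → potential k m + suc (4 * k) * m) (length-allFin n))

theorem9 : (n : ℕ) → Σ (Alg n) λ A → Σ ℕ λ d →
             (d * d ≤ 16 * n ^ 3) × ((val : Fin n → ℚ) → SortsWithin val A d)
theorem9 zero    = toAlg (Sorting.sortAll 0) , 0 , z≤n , sortAll-sortsWithin 0
theorem9 (suc n) =
  let k , lo , hi = interval threshold threshold-increasing {suc n} (s≤s z≤n)
  in  toAlg (Sorting.sortAll k) , _ , cost-bound k lo hi , sortAll-sortsWithin k
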